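{- Let $n\in\mathbb{N}$, let $\mathcal{F}$ be the set of all functions $[n]\to[n]$, let $\mathcal{S}_1,\dots,\mathcal{S}_n\subseteq[n]$ be sets of size $c$, and for $f\in\mathcal{F}$ let $\mathcal{K}_f:=\{y\in[n]: y\in f(\mathcal{S}_y)\}$. Then for every $\mu\in[0,\tfrac12]$, $$\Pr_{f\leftarrow\mathcal{F}}\big[|\mathcal{K}_f|\ge\mu n\big]\le 2^{\,2\lceil\mu n\rceil\log(1/\mu)+\lceil\mu n\rceil\log(c/n)}.$$
   Context: Logarithms base 2; $f(\mathcal{S})=\{f(x):x\in\mathcal{S}\}$; $f\leftarrow\mathcal{F}$ is uniform.
   Formalization: The parameter μ ranges over the rationals in $[0,\tfrac12]$. -}

module Defs where

open import Data.Nat as ℕ using (ℕ; zero; suc; NonZero)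
open import Data.Nat.Properties as ℕP using ()
open import Data.Integer as ℤ using (ℤ; +_)
open import Data.Rational as ℚ using (ℚ; _≤_; _*_; _/_; 1ℚ; ceiling)
open import Data.Rational.Properties using (_≤?_)
open import Data.Fin using (Fin; zero; suc)
open import Data.Fin.Subset using (Subset; ∣_∣)
open import Data.Fin.Subset.Properties using (_∈?_)
open import Data.Fin.Properties using (_≟_; any?)
open import Data.Vec using (tabulate)
open import Data.List using (List; []; _∷_; map; concatMap; allFin; filter; length)
open import Data.Product.Relation.Unary.All using ()
open import Relation.Nullary using (does)
open import Relation.Nullary.Decidable using (_×-dec_)

-- the set 𝓕 of all functions Fin m → Fin k, enumerated as a list (one entry per function)
allFuns : (m k : ℕ) → List (Fin m → Fin k)
allFuns zero    k = (λ ()) ∷ []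
allFuns (suc m) k =
  concatMap (λ a → map (λ g → λ { zero → a ; (suc i) → g i }) (allFuns m k)) (allFin k)

K : {n : ℕ} → (Fin n → Subset n) → (Fin n → Fin n) → Subset n
K {n} S f = tabulate (λ y → does (any? (λ x → (x ∈? S y) ×-dec (f x ≟ y))))

-- n ^ n is never zero (0 ^ 0 = 1)
nⁿ : ℕ → ℕ
nⁿ n = n ℕ.^ n

nⁿ-nonZero : (n : ℕ) → NonZero (nⁿ n)
nⁿ-nonZero zero    = _
nⁿ-nonZero (suc m) = ℕP.m^n≢0 (suc m) (suc m)

ℕ→ℚ : ℕ → ℚ
ℕ→ℚ m = + m / 1

PrBig : (n : ℕ) → (Fin n → Subset n) → ℚ → ℚ
PrBig n S μ =
  + length (filter (λ f → (μ * ℕ→ℚ n) ≤? ℕ→ℚ ∣ K S f ∣) (allFuns n n))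
    / nⁿ n
    where instance _ = nⁿ-nonZero n

_^ℚ_ : ℚ → ℕ → ℚ
q ^ℚ zero  = 1ℚ
q ^ℚ suc k = q * (q ^ℚ k)

-- ⌈ μ n ⌉ as a natural number (μ ≥ 0, so the ceiling is non-negative)
ceilμn : ℚ → ℕ → ℕ
ceilμn μ n = ℤ.∣ ceiling (μ * ℕ→ℚ n) ∣

-- Write μ = a / d and k = ⌈μ n⌉. If |𝒦_f| ≥ μ n then 𝒦_f contains a k-set T each of whose points y is hit by f
-- from 𝒮_y. The number of f : [m] → [n] hitting every y ∈ T from its 𝒮_y is at most ∏_{y ∈ T} |𝒮_y| · n^(m − |T|),
-- by induction on m, splitting on the value of f at one point of the domain. A union bound over the C(n,k) sets T
-- gives Pr · n^k ≤ C(n,k) c^k, and it remains to see C(n,k) μ^(2k) ≤ 1. For n ≤ 2k this is C(n,k) ≤ 2^n ≤ μ^(−2k);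
-- for n ≥ 2k we have C(n,k) k^(2k) ≤ n^(2k), since n^(2k) / C(n,k) grows with n by Bernoulli's inequality, and μ n ≤ k.

module Submission where

module Binomial where

  open import Data.Nat
  open import Data.Nat.Properties
  open import Data.Nat.Combinatorics using (_C_; nC1≡n; nCk+nC[k+1]≡[n+1]C[k+1])
  open import Data.Nat.Solver using (module +-*-Solver)
  open import Data.Product using (_,_)
  open import Data.Sum using (inj₁; inj₂)
  open import Relation.Binary.PropositionalEquality
  open +-*-Solver

  ^-distribʳ-* : ∀ m n o → (m * n) ^ o ≡ m ^ o * n ^ o
  ^-distribʳ-* m n zero    = refl
  ^-distribʳ-* m n (suc o) = begin
    m * n * (m * n) ^ o     ≡⟨ cong (m * n *_) (^-distribʳ-* m n o) ⟩
    m * n * (m ^ o * n ^ o) ≡⟨ solve 4 (λ m n x y → m :* n :* (x :* y) := m :* x :* (n :* y)) refl m n (m ^ o) (n ^ o) ⟩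
    m * m ^ o * (n * n ^ o) ∎
    where open ≡-Reasoning

  bernoulli-inequality : ∀ N p d → p ^ N * (p + N * d) ≤ p * (p + d) ^ N
  bernoulli-inequality zero    p d = ≤-reflexive (solve 1 (λ p → con 1 :* (p :+ con 0) := p :* con 1) refl p)
  bernoulli-inequality (suc N) p d = begin
    p ^ suc N * (p + suc N * d)                       ≤⟨ m≤m+n _ (p ^ N * N * d * d) ⟩
    p ^ suc N * (p + suc N * d) + p ^ N * N * d * d   ≡⟨ solve 4 (λ p d N x → p :* x :* (p :+ (con 1 :+ N) :* d) :+ x :* N :* d :* d
                                                                             := (p :+ d) :* (x :* (p :+ N :* d))) refl p d N (p ^ N) ⟩
    (p + d) * (p ^ N * (p + N * d))                   ≤⟨ *-monoʳ-≤ (p + d) (bernoulli-inequality N p d) ⟩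
    (p + d) * (p * (p + d) ^ N)                       ≡⟨ solve 3 (λ p d y → (p :+ d) :* (p :* y) := p :* ((p :+ d) :* y)) refl p d ((p + d) ^ N) ⟩
    p * (p + d) ^ suc N                               ∎
    where open ≤-Reasoning

  pascal : ∀ n k → suc n C suc k ≡ n C k + n C suc k
  pascal n k = sym (nCk+nC[k+1]≡[n+1]C[k+1] n k)

  nCk≤2^n : ∀ n k → n C k ≤ 2 ^ n
  nCk≤2^n zero    zero    = ≤-refl
  nCk≤2^n zero    (suc k) = z≤n
  nCk≤2^n (suc n) zero    = m^n>0 2 (suc n)
  nCk≤2^n (suc n) (suc k) = begin
    suc n C suc k       ≡⟨ pascal n k ⟩
    n C k + n C suc k   ≤⟨ +-mono-≤ (nCk≤2^n n k) (nCk≤2^n n (suc k)) ⟩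
    2 ^ n + 2 ^ n       ≡⟨ cong (2 ^ n +_) (sym (+-identityʳ (2 ^ n))) ⟩
    2 ^ suc n           ∎
    where open ≤-Reasoning

  C-absorption : ∀ n k → (suc n C suc k) * suc k ≡ suc n * (n C k)
  C-absorption zero    zero    = refl
  C-absorption zero    (suc k) = refl
  C-absorption (suc n) zero    = cong (_* 1) (nC1≡n (suc (suc n)))
  C-absorption (suc n) (suc k) = begin
    (suc (suc n) C suc (suc k)) * suc (suc k) ≡⟨ cong (_* suc (suc k)) (pascal (suc n) (suc k)) ⟩
    (b + a) * suc (suc k)                     ≡⟨ solve 3 (λ a b k → (b :+ a) :* (con 2 :+ k) := b :* (con 1 :+ k) :+ a :* (con 2 :+ k) :+ b) refl a b k ⟩
    b * suc k + a * suc (suc k) + b           ≡⟨ cong₂ (λ x y → x + y + b) (C-absorption n k) (C-absorption n (suc k)) ⟩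
    suc n * (n C k) + suc n * (n C suc k) + b ≡⟨ cong (_+ b) (sym (*-distribˡ-+ (suc n) (n C k) (n C suc k))) ⟩
    suc n * (n C k + n C suc k) + b           ≡⟨ cong (λ x → suc n * x + b) (sym (pascal n k)) ⟩
    suc n * b + b                             ≡⟨ solve 2 (λ n b → (con 1 :+ n) :* b :+ b := (con 2 :+ n) :* b) refl n b ⟩
    suc (suc n) * b                           ∎
    where
      open ≡-Reasoning
      a = suc n C suc (suc k)
      b = suc n C suc k

  -- (n + 1 − k) C(n + 1, k) = (n + 1) C(n, k), with n = k + u so that no subtraction occurs.
  C-absorption-complement : ∀ k u → (suc (k + u) C k) * suc u ≡ suc (k + u) * ((k + u) C k)
  C-absorption-complement k u = +-cancelˡ-≡ (b * k) _ _ (begin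
    b * k + b * suc u                   ≡⟨ sym (*-distribˡ-+ b k (suc u)) ⟩
    b * (k + suc u)                     ≡⟨ cong (b *_) (+-suc k u) ⟩
    b * suc (k + u)                     ≡⟨ weighted-pascal (k + u) k ⟩
    b * k + suc (k + u) * ((k + u) C k) ∎)
    where
      open ≡-Reasoning
      b = suc (k + u) C k
      weighted-pascal : ∀ n k → (suc n C k) * suc n ≡ (suc n C k) * k + suc n * (n C k)
      weighted-pascal n zero    = solve 1 (λ n → con 1 :* (con 1 :+ n) := con 1 :* con 0 :+ (con 1 :+ n) :* con 1) refl n
      weighted-pascal n (suc k) = begin
        (suc n C suc k) * suc n                       ≡⟨ cong (_* suc n) (pascal n k) ⟩
        (n C k + n C suc k) * suc n                   ≡⟨ solve 3 (λ x y n → (x :+ y) :* (con 1 :+ n) := (con 1 :+ n) :* x :+ (con 1 :+ n) :* y) refl (n C k) (n C suc k) n ⟩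
        suc n * (n C k) + suc n * (n C suc k)         ≡⟨ cong (_+ suc n * (n C suc k)) (sym (C-absorption n k)) ⟩
        (suc n C suc k) * suc k + suc n * (n C suc k) ∎

  2*k≡k+k : ∀ k → 2 * k ≡ k + k
  2*k≡k+k k = cong (k +_) (+-identityʳ k)

  [k+k]Ck*k^2k≤[k+k]^2k : ∀ k → ((k + k) C k) * k ^ (2 * k) ≤ (k + k) ^ (2 * k)
  [k+k]Ck*k^2k≤[k+k]^2k k = begin
    ((k + k) C k) * k ^ (2 * k) ≤⟨ *-monoˡ-≤ (k ^ (2 * k)) (nCk≤2^n (k + k) k) ⟩
    2 ^ (k + k) * k ^ (2 * k)   ≡⟨ cong (λ e → 2 ^ e * k ^ (2 * k)) (sym (2*k≡k+k k)) ⟩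
    2 ^ (2 * k) * k ^ (2 * k)   ≡⟨ sym (^-distribʳ-* 2 k (2 * k)) ⟩
    (2 * k) ^ (2 * k)           ≡⟨ cong (_^ (2 * k)) (2*k≡k+k k) ⟩
    (k + k) ^ (2 * k)           ∎
    where open ≤-Reasoning

  -- n^{2k} / C(n,k) is non-decreasing in n ≥ 2k: multiply through by (n − k + 1) n and use Bernoulli.
  nCk*k^2k≤n^2k-step : ∀ k t → .{{NonZero k}} →
    let n = k + (k + t) in (n C k) * k ^ (2 * k) ≤ n ^ (2 * k) → (suc n C k) * k ^ (2 * k) ≤ suc n ^ (2 * k)
  nCk*k^2k≤n^2k-step k t ih = *-cancelʳ-≤ _ _ (suc u * n) {{m*n≢0 (suc u) n {{_}} {{n≢0}}}} (begin
    (suc n C k) * κ * (suc u * n)           ≡⟨ solve 4 (λ b κ s n → b :* κ :* (s :* n) := b :* s :* κ :* n) refl (suc n C k) κ (suc u) n ⟩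
    (suc n C k) * suc u * κ * n             ≡⟨ cong (λ x → x * κ * n) (C-absorption-complement k u) ⟩
    suc n * (n C k) * κ * n                 ≡⟨ cong (_* n) (*-assoc (suc n) (n C k) κ) ⟩
    suc n * ((n C k) * κ) * n               ≤⟨ *-monoˡ-≤ n (*-monoʳ-≤ (suc n) ih) ⟩
    suc n * n ^ (2 * k) * n                 ≡⟨ solve 3 (λ s y n → s :* y :* n := y :* (n :* s)) refl (suc n) (n ^ (2 * k)) n ⟩
    n ^ (2 * k) * (n * suc n)               ≤⟨ *-monoʳ-≤ (n ^ (2 * k)) growth ⟩
    n ^ (2 * k) * (suc u * (n + 2 * k * 1)) ≡⟨ solve 3 (λ y s m → y :* (s :* m) := s :* (y :* m)) refl (n ^ (2 * k)) (suc u) (n + 2 * k * 1) ⟩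
    suc u * (n ^ (2 * k) * (n + 2 * k * 1)) ≤⟨ *-monoʳ-≤ (suc u) (bernoulli-inequality (2 * k) n 1) ⟩
    suc u * (n * (n + 1) ^ (2 * k))         ≡⟨ solve 3 (λ s n z → s :* (n :* z) := z :* (s :* n)) refl (suc u) n ((n + 1) ^ (2 * k)) ⟩
    (n + 1) ^ (2 * k) * (suc u * n)         ≡⟨ cong (λ m → m ^ (2 * k) * (suc u * n)) (+-comm n 1) ⟩
    suc n ^ (2 * k) * (suc u * n)           ∎)
    where
      open ≤-Reasoning
      u = k + t
      n = k + u
      κ = k ^ (2 * k)
      n≢0 : NonZero n
      n≢0 = >-nonZero (≤-trans (>-nonZero⁻¹ k) (m≤m+n k u))
      growth : n * suc n ≤ suc u * (n + 2 * k * 1)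
      growth = ≤-trans (m≤m+n _ (k * t + 2 * k)) (≤-reflexive
        (solve 2 (λ k t → (k :+ (k :+ t)) :* (con 1 :+ (k :+ (k :+ t))) :+ (k :* t :+ con 2 :* k)
                       := (con 1 :+ (k :+ t)) :* ((k :+ (k :+ t)) :+ con 2 :* k :* con 1)) refl k t))

  nCk*k^2k≤n^2k : ∀ {n k} → 2 * k ≤ n → (n C k) * k ^ (2 * k) ≤ n ^ (2 * k)
  nCk*k^2k≤n^2k {n} {zero}  _    = ≤-refl
  nCk*k^2k≤n^2k {n} {k@(suc _)} 2k≤n with t , refl ← m≤n⇒∃[o]m+o≡n 2k≤n =
    subst P (solve 2 (λ k t → k :+ (k :+ t) := con 2 :* k :+ t) refl k t) (from-central t)
    where
      P : ℕ → Set
      P m = (m C k) * k ^ (2 * k) ≤ m ^ (2 * k)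
      from-central : ∀ t → P (k + (k + t))
      from-central zero    = subst P (cong (k +_) (sym (+-identityʳ k))) ([k+k]Ck*k^2k≤[k+k]^2k k)
      from-central (suc t) = subst P (sym (trans (cong (k +_) (+-suc k t)) (+-suc k (k + t))))
        (nCk*k^2k≤n^2k-step k t (from-central t))

  -- With μ = a / d this reads C(n,k) μ^{2k} ≤ 1 whenever μ ≤ 1/2 and μ n ≤ k.
  nCk*a^2k≤d^2k : ∀ {n k a d} → 2 * a ≤ d → a * n ≤ k * d → (n C k) * a ^ (2 * k) ≤ d ^ (2 * k)
  nCk*a^2k≤d^2k {n} {zero} _ _ = ≤-refl
  nCk*a^2k≤d^2k {n} {k@(suc _)} {a} {d} 2a≤d an≤kd with ≤-total n (2 * k)
  ... | inj₁ n≤2k = begin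
    (n C k) * a ^ (2 * k)       ≤⟨ *-monoˡ-≤ (a ^ (2 * k)) (≤-trans (nCk≤2^n n k) (^-monoʳ-≤ 2 n≤2k)) ⟩
    2 ^ (2 * k) * a ^ (2 * k)   ≡⟨ sym (^-distribʳ-* 2 a (2 * k)) ⟩
    (2 * a) ^ (2 * k)           ≤⟨ ^-monoˡ-≤ (2 * k) 2a≤d ⟩
    d ^ (2 * k)                 ∎
    where open ≤-Reasoning
  ... | inj₂ 2k≤n = *-cancelʳ-≤ _ _ (n ^ (2 * k)) {{m^n≢0 n (2 * k) {{n≢0}}}} (begin
    (n C k) * a ^ (2 * k) * n ^ (2 * k)   ≡⟨ trans (*-assoc (n C k) _ _) (cong ((n C k) *_) (sym (^-distribʳ-* a n (2 * k)))) ⟩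
    (n C k) * (a * n) ^ (2 * k)           ≤⟨ *-monoʳ-≤ (n C k) (^-monoˡ-≤ (2 * k) an≤kd) ⟩
    (n C k) * (k * d) ^ (2 * k)           ≡⟨ trans (cong ((n C k) *_) (^-distribʳ-* k d (2 * k))) (sym (*-assoc (n C k) _ _)) ⟩
    (n C k) * k ^ (2 * k) * d ^ (2 * k)   ≤⟨ *-monoˡ-≤ (d ^ (2 * k)) (nCk*k^2k≤n^2k {n} {k} 2k≤n) ⟩
    n ^ (2 * k) * d ^ (2 * k)             ≡⟨ *-comm (n ^ (2 * k)) _ ⟩
    d ^ (2 * k) * n ^ (2 * k)             ∎)
    where
      open ≤-Reasoning
      n≢0 : NonZero n
      n≢0 = >-nonZero (≤-trans (s≤s z≤n) 2k≤n)

module Covering where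

  open import Defs using (allFuns; K)
  open import Data.Nat
  open import Data.Nat.Properties
  open import Data.Nat.Combinatorics using (_C_; nCk+nC[k+1]≡[n+1]C[k+1])
  import Data.Nat.ListAction as ListAction
  open import Data.Nat.Solver using (module +-*-Solver)
  open import Data.Bool using (Bool; true; false; if_then_else_; _∧_)
  open import Data.Bool.Properties using () renaming (_≟_ to _≟ᵇ_)
  open import Data.Fin using (Fin; zero; suc)
  open import Data.Fin.Properties using (all?; any?) renaming (_≟_ to _≟ᶠ_)
  open import Data.Fin.Subset using (Subset; ∣_∣)
  open import Data.Fin.Subset.Properties using (_∈?_)
  open import Data.Vec using (Vec; _∷_; []; lookup; tail)
  open import Data.Vec.Properties using (lookup∘tabulate; []=⇒lookup)
  import Data.Vec.Functional as Vector
  open import Data.List using (List; []; _∷_; _++_; map; concatMap; filter; length; tabulate; allFin)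
  open import Data.List.Properties using (length-filter; filter-reject; filter-++; length-++; length-map)
  open import Data.List.Membership.Propositional using () renaming (_∈_ to _∈ᴸ_)
  open import Data.List.Membership.Propositional.Properties using (∈-map⁺; ∈-++⁺ˡ; ∈-++⁺ʳ)
  open import Data.List.Relation.Unary.Any using (here; there)
  open import Data.List.Relation.Unary.All as All using (All; []; _∷_)
  import Data.List.Relation.Unary.All.Properties as All
  open import Data.Product using (_,_; ∃-syntax; Σ-syntax; _×_; proj₁)
  open import Function using (_∘_; case_of_)
  open import Level using (0ℓ)
  open import Relation.Binary.PropositionalEquality
  open import Relation.Nullary using (Dec; yes; no; does; proof; contradiction)
  open import Relation.Nullary.Reflects using (Reflects; invert)
  open import Relation.Nullary.Decidable using (_×-dec_; _→-dec_)
  open import Relation.Unary using (Pred; Decidable; _⊆_)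
  open import Algebra.Properties.Semiring.Sum +-*-semiring using (sum; sum-cong-≗; ∑-distrib-+; *-distribˡ-sum; *-distribʳ-sum)
  open +-*-Solver

  boolToℕ : Bool → ℕ
  boolToℕ true  = 1
  boolToℕ false = 0

  sum-mono-≤ : ∀ {n} {f g : Fin n → ℕ} → (∀ i → f i ≤ g i) → sum f ≤ sum g
  sum-mono-≤ {zero}  f≤g = z≤n
  sum-mono-≤ {suc n} f≤g = +-mono-≤ (f≤g zero) (sum-mono-≤ (f≤g ∘ suc))

  sum-const : ∀ n c → sum {n} (λ _ → c) ≡ n * c
  sum-const zero    c = refl
  sum-const (suc n) c = cong (c +_) (sum-const n c)

  module _ {A : Set} {P : Pred A 0ℓ} (P? : Decidable P) where

    length-filter-concatMap : ∀ {B : Set} {n} (g : Fin n → B) (F : B → List A) →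
      length (filter P? (concatMap F (tabulate g))) ≡ sum (λ a → length (filter P? (F (g a))))
    length-filter-concatMap {n = zero}  g F = refl
    length-filter-concatMap {n = suc n} g F = begin
      length (filter P? (F (g zero) ++ concatMap F (tabulate (g ∘ suc))))
        ≡⟨ cong length (filter-++ P? (F (g zero)) _) ⟩
      length (filter P? (F (g zero)) ++ filter P? (concatMap F (tabulate (g ∘ suc))))
        ≡⟨ length-++ (filter P? (F (g zero))) ⟩
      length (filter P? (F (g zero))) + length (filter P? (concatMap F (tabulate (g ∘ suc))))
        ≡⟨ cong (length (filter P? (F (g zero))) +_) (length-filter-concatMap (g ∘ suc) F) ⟩
      sum (λ a → length (filter P? (F (g a)))) ∎
      where open ≡-Reasoning

    length-filter-map : ∀ {B : Set} (h : B → A) xs → length (filter P? (map h xs)) ≡ length (filter (P? ∘ h) xs)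
    length-filter-map h []       = refl
    length-filter-map h (x ∷ xs) with does (P? (h x))
    ... | true  = cong suc (length-filter-map h xs)
    ... | false = length-filter-map h xs

  module _ {A : Set} {P : Pred A 0ℓ} (P? : Decidable P) where

    length-filter-∷-≤ : ∀ x xs → length (filter P? xs) ≤ length (filter P? (x ∷ xs))
    length-filter-∷-≤ x xs with does (P? x)
    ... | true  = n≤1+n _
    ... | false = ≤-refl

    length-filter-∷-< : ∀ {x} xs → P x → length (filter P? xs) < length (filter P? (x ∷ xs))
    length-filter-∷-< {x} xs px with P? x
    ... | yes _  = ≤-refl
    ... | no ¬px = contradiction px ¬px

  module _ {I : Set} where

    sum-map-mono-≤ : ∀ {f g : I → ℕ} is → (∀ i → f i ≤ g i) → ListAction.sum (map f is) ≤ ListAction.sum (map g is)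
    sum-map-mono-≤ []       f≤g = z≤n
    sum-map-mono-≤ (i ∷ is) f≤g = +-mono-≤ (f≤g i) (sum-map-mono-≤ is f≤g)

    sum-map-mono-< : ∀ {f g : I → ℕ} {is j} → j ∈ᴸ is → f j < g j → (∀ i → f i ≤ g i) →
      ListAction.sum (map f is) < ListAction.sum (map g is)
    sum-map-mono-< {is = i ∷ is} (here refl) fj<gj f≤g = +-mono-<-≤ fj<gj (sum-map-mono-≤ is f≤g)
    sum-map-mono-< {is = i ∷ is} (there j∈) fj<gj f≤g = +-mono-≤-< (f≤g i) (sum-map-mono-< j∈ fj<gj f≤g)

    sum-map-*-≤-length-* : ∀ {f : I → ℕ} is M B → All (λ i → f i * M ≤ B) is → ListAction.sum (map f is) * M ≤ length is * B
    sum-map-*-≤-length-* []       M B []               = z≤n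
    sum-map-*-≤-length-* {f} (i ∷ is) M B (fiM≤B ∷ fM≤B) =
      ≤-trans (≤-reflexive (*-distribʳ-+ M (f i) _)) (+-mono-≤ fiM≤B (sum-map-*-≤-length-* is M B fM≤B))

  union-bound : ∀ {A I : Set} {Q : Pred A 0ℓ} (Q? : Decidable Q) {R : I → Pred A 0ℓ} (R? : ∀ i → Decidable (R i))
    is xs → (∀ {x} → Q x → ∃[ i ] (i ∈ᴸ is × R i x)) →
    length (filter Q? xs) ≤ ListAction.sum (map (λ i → length (filter (R? i) xs)) is)
  union-bound Q? R? is []       Q⊆⋃R = z≤n
  union-bound Q? R? is (x ∷ xs) Q⊆⋃R with Q? x
  ... | yes qx = let i , i∈ , rix = Q⊆⋃R qx in
    ≤-trans (s≤s (union-bound Q? R? is xs Q⊆⋃R))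
            (sum-map-mono-< i∈ (length-filter-∷-< (R? i) xs rix) (λ j → length-filter-∷-≤ (R? j) x xs))
  ... | no  _  = ≤-trans (union-bound Q? R? is xs Q⊆⋃R) (sum-map-mono-≤ is (λ i → length-filter-∷-≤ (R? i) x xs))

  lookup-suc : ∀ {A : Set} {m} (v : Vec A (suc m)) i → lookup v (suc i) ≡ lookup (tail v) i
  lookup-suc (x ∷ v) i = refl

  ∣∣-head-tail : ∀ {m} (p : Subset (suc m)) → ∣ p ∣ ≡ boolToℕ (lookup p zero) + ∣ tail p ∣
  ∣∣-head-tail (true  ∷ p) = refl
  ∣∣-head-tail (false ∷ p) = refl

  ∧-true : ∀ {a b} → a ∧ b ≡ true → a ≡ true
  ∧-true {true} _ = refl

  count : ∀ {n} → (Fin n → Bool) → ℕ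
  count T = sum (boolToℕ ∘ T)

  prodOn : ∀ {n} → (Fin n → Bool) → (Fin n → ℕ) → ℕ
  prodOn {zero}  T w = 1
  prodOn {suc n} T w = (if T zero then w zero else 1) * prodOn (T ∘ suc) (w ∘ suc)

  delete : ∀ {n} → Fin n → (Fin n → Bool) → Fin n → Bool
  delete zero    T zero    = false
  delete zero    T (suc y) = T (suc y)
  delete (suc a) T zero    = T zero
  delete (suc a) T (suc y) = delete a (T ∘ suc) y

  prodOn-cong : ∀ {n} (T : Fin n → Bool) {w w′ : Fin n → ℕ} → (∀ i → w i ≡ w′ i) → prodOn T w ≡ prodOn T w′
  prodOn-cong {zero}  T w≗w′ = refl
  prodOn-cong {suc n} T w≗w′ = cong₂ _*_ (cong (if T zero then_else 1) (w≗w′ zero)) (prodOn-cong (T ∘ suc) (w≗w′ ∘ suc))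

  prodOn-const : ∀ {n} (T : Fin n → Bool) c → prodOn T (λ _ → c) ≡ c ^ count T
  prodOn-const {zero}  T c = refl
  prodOn-const {suc n} T c with T zero
  ... | true  = cong (c *_) (prodOn-const (T ∘ suc) c)
  ... | false = trans (+-identityʳ _) (prodOn-const (T ∘ suc) c)

  prodOn-empty : ∀ {n} (T : Fin n → Bool) w → count T ≡ 0 → prodOn T w ≡ 1
  prodOn-empty {zero}  T w _ = refl
  prodOn-empty {suc n} T w #T≡0 with T zero
  ... | false = trans (+-identityʳ _) (prodOn-empty (T ∘ suc) (w ∘ suc) #T≡0)

  delete-⊆ : ∀ {n} (T : Fin n → Bool) a y → delete a T y ≡ true → T y ≡ true
  delete-⊆ T zero    (suc y) T′y = T′y
  delete-⊆ T (suc a) zero    T′y = T′y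
  delete-⊆ T (suc a) (suc y) T′y = delete-⊆ (T ∘ suc) a y T′y

  delete-self : ∀ {n} (T : Fin n → Bool) a → delete a T a ≡ false
  delete-self T zero    = refl
  delete-self T (suc a) = delete-self (T ∘ suc) a

  count-delete : ∀ {n} (T : Fin n → Bool) a → T a ≡ true → count T ≡ suc (count (delete a T))
  count-delete T zero    Ta rewrite Ta = refl
  count-delete T (suc a) Ta =
    trans (cong (boolToℕ (T zero) +_) (count-delete (T ∘ suc) a Ta)) (+-suc (boolToℕ (T zero)) _)

  count-nonzero : ∀ {n} (T : Fin n → Bool) {c} → count T ≡ suc c → ∃[ y ] T y ≡ true
  count-nonzero {suc n} T #T≡1+c with T zero in T0
  ... | true  = zero , T0
  ... | false = let y , Ty = count-nonzero (T ∘ suc) #T≡1+c in suc y , Ty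

  -- The terms of degree ≤ 1 in z of the expansion of ∏_{y ∈ T} (z y + s y).
  prodOn-linear-terms-≤ : ∀ {n} (T z : Fin n → Bool) (s : Fin n → ℕ) →
    prodOn T s + sum (λ a → boolToℕ (T a ∧ z a) * prodOn (delete a T) s) ≤ prodOn T (λ y → boolToℕ (z y) + s y)
  prodOn-linear-terms-≤ {zero}  T z s = ≤-refl
  prodOn-linear-terms-≤ {suc n} T z s =
    ≤-trans (≤-reflexive (cong (λ x → c * P + (boolToℕ (T zero ∧ z zero) * (1 * P) + x)) pull-c))
            (head-step (T zero) (z zero) (prodOn-linear-terms-≤ (T ∘ suc) (z ∘ suc) (s ∘ suc)))
    where
      c = if T zero then s zero else 1
      P = prodOn (T ∘ suc) (s ∘ suc)
      Q = sum (λ a → boolToℕ (T (suc a) ∧ z (suc a)) * prodOn (delete a (T ∘ suc)) (s ∘ suc))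
      pull-c : sum (λ a → boolToℕ (T (suc a) ∧ z (suc a)) * (c * prodOn (delete a (T ∘ suc)) (s ∘ suc))) ≡ c * Q
      pull-c = trans (sum-cong-≗ (λ a → solve 3 (λ x c y → x :* (c :* y) := c :* (x :* y)) refl (boolToℕ (T (suc a) ∧ z (suc a))) c _))
                     (sym (*-distribˡ-sum {n} c (λ a → boolToℕ (T (suc a) ∧ z (suc a)) * prodOn (delete a (T ∘ suc)) (s ∘ suc))))
      head-step : ∀ t b {P Q R} → P + Q ≤ R →
        (if t then s zero else 1) * P + (boolToℕ (t ∧ b) * (1 * P) + (if t then s zero else 1) * Q)
          ≤ (if t then boolToℕ b + s zero else 1) * R
      head-step false b {P} {Q} P+Q≤R = ≤-trans (≤-reflexive (solve 2 (λ P Q → con 1 :* P :+ (con 0 :+ con 1 :* Q) := P :+ Q) refl P Q))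
        (≤-trans P+Q≤R (≤-reflexive (sym (*-identityˡ _))))
      head-step true false {P} {Q} P+Q≤R = ≤-trans (≤-reflexive (solve 3 (λ s P Q → s :* P :+ (con 0 :+ s :* Q) := s :* (P :+ Q)) refl (s zero) P Q))
        (*-monoʳ-≤ (s zero) P+Q≤R)
      head-step true true {P} {Q} P+Q≤R = ≤-trans (m≤m+n _ Q) (≤-trans
        (≤-reflexive (solve 3 (λ s P Q → s :* P :+ (con 1 :* (con 1 :* P) :+ s :* Q) :+ Q := (con 1 :+ s) :* (P :+ Q)) refl (s zero) P Q))
        (*-monoʳ-≤ (suc (s zero)) P+Q≤R))

  Covers : ∀ {m n} → (Fin n → Subset m) → (Fin n → Bool) → (Fin m → Fin n) → Set
  Covers S T f = ∀ y → T y ≡ true → ∃[ x ] (lookup (S y) x ≡ true × f x ≡ y)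

  -- Stated for every decidable P ⊆ Covers S T, so that the induction may restrict P to the functions with a given value at 0.
  CoveringBound : ℕ → ℕ → Set₁
  CoveringBound m n = ∀ (S : Fin n → Subset m) (T : Fin n → Bool) {P : Pred (Fin m → Fin n) 0ℓ} (P? : Decidable P) →
    P ⊆ Covers S T → length (filter P? (allFuns m n)) * n ^ count T ≤ prodOn T (∣_∣ ∘ S) * n ^ m

  -- allFuns builds a function on Fin (suc m) from its value at 0 and its tail by a pattern lambda of Defs, which is
  -- reachable only through the computation rules cons-zero and cons-suc.
  -- Split on a = f 0: the tail of f covers T minus a through S′ if a ∈ T and 0 ∈ S a, and all of T otherwise.
  module _ {m n} (cons : Fin n → (Fin m → Fin n) → Fin (suc m) → Fin n)
           (cons-zero : ∀ a g → cons a g zero ≡ a) (cons-suc : ∀ a g i → cons a g (suc i) ≡ g i)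
           (S : Fin n → Subset (suc m)) (T : Fin n → Bool) where

    private
      S′ : Fin n → Subset m
      S′ = tail ∘ S

      s′ : Fin n → ℕ
      s′ = ∣_∣ ∘ S′

      hitAt0 : Fin n → Bool
      hitAt0 a = T a ∧ lookup (S a) zero

      tail-witness : ∀ {a g y x} → lookup (S y) (suc x) ≡ true → cons a g (suc x) ≡ y →
        ∃[ x ] (lookup (S′ y) x ≡ true × g x ≡ y)
      tail-witness {a} {g} {y} {x} x∈ fx≡y = x , trans (sym (lookup-suc (S y) x)) x∈ , trans (sym (cons-suc a g x)) fx≡y

      covers-delete : ∀ a g → hitAt0 a ≡ true → Covers S T (cons a g) → Covers S′ (delete a T) g
      covers-delete a g _ covers y T′y with covers y (delete-⊆ T a y T′y)
      ... | zero  , _  , a≡y  = contradiction (trans (sym (delete-self T a)) T′a) λ ()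
        where T′a = subst (λ b → delete a T b ≡ true) (sym (trans (sym (cons-zero a g)) a≡y)) T′y
      ... | suc x , x∈ , fx≡y = tail-witness x∈ fx≡y

      covers-keep : ∀ a g → hitAt0 a ≡ false → Covers S T (cons a g) → Covers S′ T g
      covers-keep a g miss covers y Ty with covers y Ty
      ... | zero  , 0∈ , a≡y  = contradiction (trans (sym (cong₂ _∧_ Ty 0∈)) miss′) λ ()
        where miss′ = subst (λ b → hitAt0 b ≡ false) (trans (sym (cons-zero a g)) a≡y) miss
      ... | suc x , x∈ , fx≡y = tail-witness x∈ fx≡y

    covering-bound-step : CoveringBound m n → ∀ {P} (P? : Decidable P) → P ⊆ Covers S T →
      length (filter P? (concatMap (λ a → map (cons a) (allFuns m n)) (allFin n))) * n ^ count T
        ≤ prodOn T (∣_∣ ∘ S) * n ^ suc m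
    covering-bound-step bound P? P⊆covers = begin
      length (filter P? (concatMap (λ a → map (cons a) (allFuns m n)) (allFin n))) * n ^ count T
        ≡⟨ cong (_* n ^ count T) (trans (length-filter-concatMap P? (λ a → a) (λ a → map (cons a) (allFuns m n)))
                                        (sum-cong-≗ (λ a → length-filter-map P? (cons a) (allFuns m n)))) ⟩
      sum ℓ * n ^ count T
        ≡⟨ *-distribʳ-sum (n ^ count T) ℓ ⟩
      sum (λ a → ℓ a * n ^ count T)
        ≤⟨ sum-mono-≤ fixed-head ⟩
      sum (λ a → (prodOn T s′ + n * linear a) * n ^ m)
        ≡⟨ sym (*-distribʳ-sum (n ^ m) (λ a → prodOn T s′ + n * linear a)) ⟩
      sum (λ a → prodOn T s′ + n * linear a) * n ^ m
        ≡⟨ cong (_* n ^ m) (trans (∑-distrib-+ (λ _ → prodOn T s′) (λ a → n * linear a))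
                                   (cong₂ _+_ (sum-const n (prodOn T s′)) (sym (*-distribˡ-sum n linear)))) ⟩
      (n * prodOn T s′ + n * sum linear) * n ^ m
        ≡⟨ cong (_* n ^ m) (sym (*-distribˡ-+ n (prodOn T s′) (sum linear))) ⟩
      n * (prodOn T s′ + sum linear) * n ^ m
        ≤⟨ *-monoˡ-≤ (n ^ m) (*-monoʳ-≤ n (prodOn-linear-terms-≤ T (λ y → lookup (S y) zero) s′)) ⟩
      n * prodOn T (λ y → boolToℕ (lookup (S y) zero) + s′ y) * n ^ m
        ≡⟨ cong (λ p → n * p * n ^ m) (prodOn-cong T (λ y → sym (∣∣-head-tail (S y)))) ⟩
      n * prodOn T (∣_∣ ∘ S) * n ^ m
        ≡⟨ solve 3 (λ n p x → n :* p :* x := p :* (n :* x)) refl n (prodOn T (∣_∣ ∘ S)) (n ^ m) ⟩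
      prodOn T (∣_∣ ∘ S) * n ^ suc m ∎
      where
        open ≤-Reasoning
        ℓ : Fin n → ℕ
        ℓ a = length (filter (P? ∘ cons a) (allFuns m n))
        linear : Fin n → ℕ
        linear a = boolToℕ (hitAt0 a) * prodOn (delete a T) s′
        fixed-head : ∀ a → ℓ a * n ^ count T ≤ (prodOn T s′ + n * linear a) * n ^ m
        fixed-head a with hitAt0 a in hit
        ... | false = ≤-trans (bound S′ T (P? ∘ cons a) (covers-keep a _ hit ∘ P⊆covers)) (*-monoˡ-≤ (n ^ m) (m≤m+n (prodOn T s′) _))
        ... | true  = begin
          ℓ a * n ^ count T                          ≡⟨ cong (λ k → ℓ a * n ^ k) (count-delete T a (∧-true hit)) ⟩
          ℓ a * (n * n ^ count (delete a T))         ≡⟨ solve 3 (λ l n x → l :* (n :* x) := n :* (l :* x)) refl (ℓ a) n _ ⟩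
          n * (ℓ a * n ^ count (delete a T))         ≤⟨ *-monoʳ-≤ n (bound S′ (delete a T) (P? ∘ cons a) (covers-delete a _ hit ∘ P⊆covers)) ⟩
          n * (prodOn (delete a T) s′ * n ^ m)       ≡⟨ solve 3 (λ n r x → n :* (r :* x) := n :* (con 1 :* r) :* x) refl n (prodOn (delete a T) s′) (n ^ m) ⟩
          n * (1 * prodOn (delete a T) s′) * n ^ m   ≤⟨ *-monoˡ-≤ (n ^ m) (m≤n+m _ (prodOn T s′)) ⟩
          (prodOn T s′ + n * (1 * prodOn (delete a T) s′)) * n ^ m ∎

  covering-bound : ∀ m n → CoveringBound m n
  covering-bound zero n S T P? P⊆covers with count T in #T
  ... | zero  = ≤-trans (*-monoˡ-≤ 1 (length-filter P? (allFuns zero n)))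
                        (≤-reflexive (cong (_* 1) (sym (prodOn-empty T _ #T))))
  ... | suc _ with y , Ty ← count-nonzero T #T =
    subst (λ ℓ → ℓ * _ ≤ _) (sym (cong length (filter-reject P? (λ p → case proj₁ (P⊆covers p y Ty) of λ ())))) z≤n
  covering-bound (suc m) n S T = covering-bound-step _ (λ _ _ → refl) (λ _ _ _ → refl) S T (covering-bound m n)

  subsetsOfSize : ∀ n (k : ℕ) → List (Fin n → Bool)
  subsetsOfSize zero    zero    = Vector.[] ∷ []
  subsetsOfSize zero    (suc k) = []
  subsetsOfSize (suc n) zero    = map (false Vector.∷_) (subsetsOfSize n zero)
  subsetsOfSize (suc n) (suc k) = map (true Vector.∷_) (subsetsOfSize n k) ++ map (false Vector.∷_) (subsetsOfSize n (suc k))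

  length-subsetsOfSize : ∀ n k → length (subsetsOfSize n k) ≡ n C k
  length-subsetsOfSize zero    zero    = refl
  length-subsetsOfSize zero    (suc k) = refl
  length-subsetsOfSize (suc n) zero    = trans (length-map _ (subsetsOfSize n zero)) (length-subsetsOfSize n zero)
  length-subsetsOfSize (suc n) (suc k) = begin
    length (map (true Vector.∷_) (subsetsOfSize n k) ++ map (false Vector.∷_) (subsetsOfSize n (suc k)))
      ≡⟨ length-++ (map (true Vector.∷_) (subsetsOfSize n k)) ⟩
    length (map (true Vector.∷_) (subsetsOfSize n k)) + length (map (false Vector.∷_) (subsetsOfSize n (suc k)))
      ≡⟨ cong₂ _+_ (trans (length-map _ (subsetsOfSize n k)) (length-subsetsOfSize n k))
                   (trans (length-map _ (subsetsOfSize n (suc k))) (length-subsetsOfSize n (suc k))) ⟩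
    n C k + n C suc k
      ≡⟨ nCk+nC[k+1]≡[n+1]C[k+1] n k ⟩
    suc n C suc k ∎
    where open ≡-Reasoning

  count-subsetsOfSize : ∀ n k → All (λ T → count T ≡ k) (subsetsOfSize n k)
  count-subsetsOfSize zero    zero    = refl ∷ []
  count-subsetsOfSize zero    (suc k) = []
  count-subsetsOfSize (suc n) zero    = All.map⁺ (count-subsetsOfSize n zero)
  count-subsetsOfSize (suc n) (suc k) =
    All.++⁺ (All.map⁺ (All.map (cong suc) (count-subsetsOfSize n k))) (All.map⁺ (count-subsetsOfSize n (suc k)))

  ∃-subsetOfSize-⊆ : ∀ n k (p : Subset n) → k ≤ ∣ p ∣ →
    Σ[ T ∈ (Fin n → Bool) ] (T ∈ᴸ subsetsOfSize n k × (∀ y → T y ≡ true → lookup p y ≡ true))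
  ∃-subsetOfSize-⊆ zero    zero    []      _ = Vector.[] , here refl , λ ()
  ∃-subsetOfSize-⊆ (suc n) zero    (b ∷ p) _ with T , T∈ , T⊆p ← ∃-subsetOfSize-⊆ n zero p z≤n =
    false Vector.∷ T , ∈-map⁺ (false Vector.∷_) T∈ , λ { (suc y) → T⊆p y }
  ∃-subsetOfSize-⊆ (suc n) (suc k) (true ∷ p) (s≤s k≤∣p∣) with T , T∈ , T⊆p ← ∃-subsetOfSize-⊆ n k p k≤∣p∣ =
    true Vector.∷ T , ∈-++⁺ˡ (∈-map⁺ (true Vector.∷_) T∈) , λ { zero _ → refl ; (suc y) → T⊆p y }
  ∃-subsetOfSize-⊆ (suc n) (suc k) (false ∷ p) k≤∣p∣ with T , T∈ , T⊆p ← ∃-subsetOfSize-⊆ n (suc k) p k≤∣p∣ =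
    false Vector.∷ T , ∈-++⁺ʳ (map (true Vector.∷_) (subsetsOfSize n k)) (∈-map⁺ (false Vector.∷_) T∈) , λ { (suc y) → T⊆p y }

  covers? : ∀ {m n} (S : Fin n → Subset m) (T : Fin n → Bool) → Decidable (Covers S T)
  covers? S T f = all? λ y → (T y ≟ᵇ true) →-dec any? λ x → (lookup (S y) x ≟ᵇ true) ×-dec (f x ≟ᶠ y)

  does-true⇒ : ∀ {A : Set} (a? : Dec A) → does a? ≡ true → A
  does-true⇒ a? does≡true = invert (subst (Reflects _) does≡true (proof a?))

  K-covers : ∀ {n} (S : Fin n → Subset n) f → Covers S (lookup (K S f)) f
  K-covers S f y y∈K
    with x , x∈ , fx≡y ← does-true⇒ (any? λ x → (x ∈? S y) ×-dec (f x ≟ᶠ y)) (trans (sym (lookup∘tabulate _ y)) y∈K) =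
    x , []=⇒lookup x∈ , fx≡y

  count-large-K : ∀ n c (S : Fin n → Subset n) → (∀ y → ∣ S y ∣ ≡ c) → ∀ k {Q : Pred (Fin n → Fin n) 0ℓ} (Q? : Decidable Q) →
    (∀ {f} → Q f → k ≤ ∣ K S f ∣) → length (filter Q? (allFuns n n)) * n ^ k ≤ (n C k) * (c ^ k * n ^ n)
  count-large-K n c S ∣S∣≡c k {Q} Q? Q⇒k≤∣K∣ = begin
    length (filter Q? (allFuns n n)) * n ^ k
      ≤⟨ *-monoˡ-≤ (n ^ k) (union-bound Q? (covers? S) (subsetsOfSize n k) (allFuns n n) covered-subset) ⟩
    ListAction.sum (map (λ T → length (filter (covers? S T) (allFuns n n))) (subsetsOfSize n k)) * n ^ k
      ≤⟨ sum-map-*-≤-length-* (subsetsOfSize n k) (n ^ k) _ (All.map covering-count (count-subsetsOfSize n k)) ⟩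
    length (subsetsOfSize n k) * (c ^ k * n ^ n)
      ≡⟨ cong (_* (c ^ k * n ^ n)) (length-subsetsOfSize n k) ⟩
    (n C k) * (c ^ k * n ^ n) ∎
    where
      open ≤-Reasoning
      covered-subset : ∀ {f} → Q f → ∃[ T ] (T ∈ᴸ subsetsOfSize n k × Covers S T f)
      covered-subset {f} qf with T , T∈ , T⊆K ← ∃-subsetOfSize-⊆ n k (K S f) (Q⇒k≤∣K∣ qf) =
        T , T∈ , λ y Ty → K-covers S f y (T⊆K y Ty)
      covering-count : ∀ {T} → count T ≡ k → length (filter (covers? S T) (allFuns n n)) * n ^ k ≤ c ^ k * n ^ n
      covering-count {T} refl = ≤-trans (covering-bound n n S T (covers? S T) (λ covers → covers))
        (≤-reflexive (cong (_* n ^ n) (trans (prodOn-cong T ∣S∣≡c) (prodOn-const T c))))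

module Fractions where

  open import Defs using (_^ℚ_; ℕ→ℚ)
  open import Data.Nat as ℕ using (ℕ; zero; suc; z≤n; s≤s; NonZero)
  import Data.Nat.Properties as ℕ
  open import Data.Nat.Coprimality using (Coprime)
  open import Data.Integer as ℤ using (+_; -[1+_])
  import Data.Integer.Properties as ℤ
  open import Data.Integer.DivMod using ([n/ℕd]*d≤n; n<s[n/ℕd]*d; div-pos-is-/ℕ)
  open import Data.Integer.Solver using (module +-*-Solver)
  open import Data.Rational as ℚ using (ℚ; mkℚ; 0ℚ; ceiling; toℚᵘ)
  open import Data.Rational.Properties using (toℚᵘ-homo-*; toℚᵘ-fromℚᵘ; toℚᵘ-mono-≤; toℚᵘ-cancel-≤)
  open import Data.Rational.Unnormalised as ℚᵘ using (mkℚᵘ; *≤*)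
  import Data.Rational.Unnormalised.Properties as ℚᵘ
  open import Data.Product using (_,_; _×_)
  open import Relation.Binary.PropositionalEquality

  -- The floor characterisation of ℤ division, applied to ⌈P / e⌉ = - ⌊- P / e⌋.
  ⌈⌉-bounds : ∀ P e-1 .(cop : Coprime P (suc e-1)) → let k = ℤ.∣ ⌈ mkℚ (+ P) e-1 cop ⌉ ∣ in
    P ℕ.≤ k ℕ.* suc e-1 × k ℕ.* suc e-1 ℕ.< P ℕ.+ suc e-1
  ⌈⌉-bounds zero    e-1 _ = z≤n , s≤s z≤n
  ⌈⌉-bounds (suc P) e-1 cop =
    subst (λ C → suc P ℕ.≤ ℤ.∣ C ∣ ℕ.* e × ℤ.∣ C ∣ ℕ.* e ℕ.< suc P ℕ.+ e)
          (sym (cong ℤ.-_ (div-pos-is-/ℕ -[1+ P ] e))) (bounds (ℤ.- q) P≤ <P+e)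
    where
      e = suc e-1
      q = -[1+ P ] ℤ./ℕ e
      P≤ : + suc P ℤ.≤ ℤ.- q ℤ.* + e
      P≤ = subst (+ suc P ℤ.≤_) (ℤ.neg-distribˡ-* q (+ e)) (ℤ.neg-mono-≤ ([n/ℕd]*d≤n -[1+ P ] e))
      <P+e : ℤ.- q ℤ.* + e ℤ.< + suc P ℤ.+ + e
      <P+e = subst (ℤ._< + suc P ℤ.+ + e)
        (solve 2 (λ q e → (:- ((con (+ 1) :+ q) :* e)) :+ e := (:- q) :* e) refl q (+ e))
        (ℤ.+-monoˡ-< (+ e) (ℤ.neg-mono-< (n<s[n/ℕd]*d -[1+ P ] e)))
        where open +-*-Solver
      bounds : ∀ C → + suc P ℤ.≤ C ℤ.* + e → C ℤ.* + e ℤ.< + suc P ℤ.+ + e →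
        suc P ℕ.≤ ℤ.∣ C ∣ ℕ.* e × ℤ.∣ C ∣ ℕ.* e ℕ.< suc P ℕ.+ e
      bounds (+ k) P≤ke ke<P+e = ℤ.drop‿+≤+ (subst (+ suc P ℤ.≤_) (sym (ℤ.pos-* k e)) P≤ke)
                               , ℤ.drop‿+<+ (subst (ℤ._< + (suc P ℕ.+ e)) (sym (ℤ.pos-* k e)) ke<P+e)
      bounds -[1+ c ] () _

  /-*-/ : ∀ x y z w .{{_ : NonZero y}} .{{_ : NonZero w}} →
    (+ x ℚᵘ./ y) ℚᵘ.* (+ z ℚᵘ./ w) ℚᵘ.≃ (+ (x ℕ.* z) ℚᵘ./ (y ℕ.* w)) {{ℕ.m*n≢0 y w}}
  /-*-/ x (suc _) z (suc _) = ℚᵘ.≃-reflexive (cong (λ i → mkℚᵘ i _) (sym (ℤ.pos-* x z)))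

  toℚᵘ-/ : ∀ x y .{{_ : NonZero y}} → toℚᵘ (+ x ℚ./ y) ℚᵘ.≃ + x ℚᵘ./ y
  toℚᵘ-/ x (suc y) = toℚᵘ-fromℚᵘ (mkℚᵘ (+ x) y)

  toℚᵘ-* : ∀ {p q} x y z w .{{_ : NonZero y}} .{{_ : NonZero w}} →
    toℚᵘ p ℚᵘ.≃ + x ℚᵘ./ y → toℚᵘ q ℚᵘ.≃ + z ℚᵘ./ w →
    toℚᵘ (p ℚ.* q) ℚᵘ.≃ (+ (x ℕ.* z) ℚᵘ./ (y ℕ.* w)) {{ℕ.m*n≢0 y w}}
  toℚᵘ-* {p} {q} x y z w p≃x/y q≃z/w = ℚᵘ.≃-trans (toℚᵘ-homo-* p q) (ℚᵘ.≃-trans (ℚᵘ.*-cong p≃x/y q≃z/w) (/-*-/ x y z w))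

  toℚᵘ-^ℚ : ∀ {q} x y .{{_ : NonZero y}} → toℚᵘ q ℚᵘ.≃ + x ℚᵘ./ y →
    ∀ j → toℚᵘ (q ^ℚ j) ℚᵘ.≃ (+ (x ℕ.^ j) ℚᵘ./ (y ℕ.^ j)) {{ℕ.m^n≢0 y j}}
  toℚᵘ-^ℚ         x y q≃x/y zero    = ℚᵘ.≃-refl
  toℚᵘ-^ℚ         x y q≃x/y (suc j) = toℚᵘ-* x y (x ℕ.^ j) (y ℕ.^ j) {{_}} {{ℕ.m^n≢0 y j}} q≃x/y (toℚᵘ-^ℚ x y q≃x/y j)

  toℚᵘ-ℕ→ℚ-^ℚ : ∀ m j → toℚᵘ (ℕ→ℚ m ^ℚ j) ℚᵘ.≃ + (m ℕ.^ j) ℚᵘ./ 1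
  toℚᵘ-ℕ→ℚ-^ℚ m zero    = ℚᵘ.≃-refl
  toℚᵘ-ℕ→ℚ-^ℚ m (suc j) = toℚᵘ-* m 1 (m ℕ.^ j) 1 (toℚᵘ-/ m 1) (toℚᵘ-ℕ→ℚ-^ℚ m j)

  cross-≤⁺ : ∀ {p q} x y z w .{{_ : NonZero y}} .{{_ : NonZero w}} →
    toℚᵘ p ℚᵘ.≃ + x ℚᵘ./ y → toℚᵘ q ℚᵘ.≃ + z ℚᵘ./ w → x ℕ.* w ℕ.≤ z ℕ.* y → p ℚ.≤ q
  cross-≤⁺ x y@(suc _) z w@(suc _) p≃x/y q≃z/w xw≤zy = toℚᵘ-cancel-≤
    (ℚᵘ.≤-respˡ-≃ (ℚᵘ.≃-sym p≃x/y) (ℚᵘ.≤-respʳ-≃ (ℚᵘ.≃-sym q≃z/w)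
      (*≤* (subst₂ ℤ._≤_ (ℤ.pos-* x w) (ℤ.pos-* z y) (ℤ.+≤+ xw≤zy)))))

  cross-≤⁻ : ∀ {p q} x y z w .{{_ : NonZero y}} .{{_ : NonZero w}} →
    toℚᵘ p ℚᵘ.≃ + x ℚᵘ./ y → toℚᵘ q ℚᵘ.≃ + z ℚᵘ./ w → p ℚ.≤ q → x ℕ.* w ℕ.≤ z ℕ.* y
  cross-≤⁻ x y@(suc _) z w@(suc _) p≃x/y q≃z/w p≤q
    with *≤* xw≤zy ← ℚᵘ.≤-respˡ-≃ p≃x/y (ℚᵘ.≤-respʳ-≃ q≃z/w (toℚᵘ-mono-≤ p≤q)) =
    ℤ.drop‿+≤+ (subst₂ ℤ._≤_ (sym (ℤ.pos-* x w)) (sym (ℤ.pos-* z y)) xw≤zy)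

  ≤-⌈⌉ : ∀ {q} → 0ℚ ℚ.≤ q → q ℚ.≤ ℕ→ℚ ℤ.∣ ⌈ q ⌉ ∣
  ≤-⌈⌉ {q@(mkℚ (+ P) e-1 cop)} _ with P≤ke , _ ← ⌈⌉-bounds P e-1 cop =
    cross-≤⁺ P (suc e-1) k 1 ℚᵘ.≃-refl (toℚᵘ-/ k 1) (subst (ℕ._≤ k ℕ.* suc e-1) (sym (ℕ.*-identityʳ P)) P≤ke)
    where k = ℤ.∣ ⌈ q ⌉ ∣
  ≤-⌈⌉ {mkℚ -[1+ _ ] _ _} (ℚ.*≤* ())

  ⌈⌉-≤ : ∀ {q} m → 0ℚ ℚ.≤ q → q ℚ.≤ ℕ→ℚ m → ℤ.∣ ⌈ q ⌉ ∣ ℕ.≤ m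
  ⌈⌉-≤ {mkℚ (+ P) e-1 cop} m _ q≤m with _ , ke<P+e ← ⌈⌉-bounds P e-1 cop =
    ℕ.≤-pred (ℕ.*-cancelʳ-< e _ (suc m) (ℕ.<-≤-trans ke<P+e (begin
      P ℕ.+ e          ≡⟨ ℕ.+-comm P e ⟩
      e ℕ.+ P          ≤⟨ ℕ.+-monoʳ-≤ e (subst (ℕ._≤ m ℕ.* e) (ℕ.*-identityʳ P) P*1≤m*e) ⟩
      e ℕ.+ m ℕ.* e    ∎)))
    where
      open ℕ.≤-Reasoning
      e = suc e-1
      P*1≤m*e = cross-≤⁻ P e m 1 ℚᵘ.≃-refl (toℚᵘ-/ m 1) q≤m
  ⌈⌉-≤ {mkℚ -[1+ _ ] _ _} m (ℚ.*≤* ()) _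

open import Defs
open import Data.Nat using (ℕ; suc; z≤n; NonZero) renaming (_*_ to _*ℕ_)
import Data.Nat as ℕ
import Data.Nat.Properties as ℕ
open import Data.Nat.Combinatorics using (_C_)
open import Data.Nat.Coprimality using (Coprime)
open import Data.Nat.Solver using (module +-*-Solver)
open import Data.Integer using (+_; -[1+_])
open import Data.Rational using (ℚ; _≤_; _*_; 0ℚ; ½; mkℚ; toℚᵘ; *≤*)
open import Data.Rational.Properties using (_≤?_)
import Data.Rational.Unnormalised as ℚᵘ
import Data.Rational.Unnormalised.Properties as ℚᵘ
open import Data.Fin using (Fin)
open import Data.Fin.Subset using (Subset; ∣_∣)
open import Data.List using (length; filter)
open import Relation.Binary.PropositionalEquality
open Binomial using (nCk*a^2k≤d^2k)
open Covering using (count-large-K)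
open Fractions using (toℚᵘ-/; toℚᵘ-*; toℚᵘ-^ℚ; toℚᵘ-ℕ→ℚ-^ℚ; cross-≤⁺; cross-≤⁻; ≤-⌈⌉; ⌈⌉-≤)

N*a^2k*n^k≤c^k*nⁿ*d^2k : ∀ {N n k c a d} → N *ℕ n ℕ.^ k ℕ.≤ (n C k) *ℕ (c ℕ.^ k *ℕ n ℕ.^ n) →
  (n C k) *ℕ a ℕ.^ (2 *ℕ k) ℕ.≤ d ℕ.^ (2 *ℕ k) →
  N *ℕ (a ℕ.^ (2 *ℕ k) *ℕ n ℕ.^ k) ℕ.≤ c ℕ.^ k *ℕ (n ℕ.^ n *ℕ d ℕ.^ (2 *ℕ k))
N*a^2k*n^k≤c^k*nⁿ*d^2k {N} {n} {k} {c} {a} {d} count-bound binomial-bound = begin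
  N *ℕ (A *ℕ n ℕ.^ k)                   ≡⟨ solve 3 (λ N A X → N :* (A :* X) := N :* X :* A) refl N A (n ℕ.^ k) ⟩
  N *ℕ n ℕ.^ k *ℕ A                     ≤⟨ ℕ.*-monoˡ-≤ A count-bound ⟩
  (n C k) *ℕ (c ℕ.^ k *ℕ n ℕ.^ n) *ℕ A  ≡⟨ solve 4 (λ B C Y A → B :* (C :* Y) :* A := B :* A :* (C :* Y)) refl (n C k) (c ℕ.^ k) (n ℕ.^ n) A ⟩
  (n C k) *ℕ A *ℕ (c ℕ.^ k *ℕ n ℕ.^ n)  ≤⟨ ℕ.*-monoˡ-≤ _ binomial-bound ⟩
  D *ℕ (c ℕ.^ k *ℕ n ℕ.^ n)             ≡⟨ solve 3 (λ D C Y → D :* (C :* Y) := C :* (Y :* D)) refl D (c ℕ.^ k) (n ℕ.^ n) ⟩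
  c ℕ.^ k *ℕ (n ℕ.^ n *ℕ D)             ∎
  where
    open ℕ.≤-Reasoning
    open +-*-Solver
    A = a ℕ.^ (2 *ℕ k)
    D = d ℕ.^ (2 *ℕ k)

#large : (n : ℕ) → (Fin n → Subset n) → ℚ → ℕ
#large n S μ = length (filter (λ f → μ * ℕ→ℚ n ≤? ℕ→ℚ ∣ K S f ∣) (allFuns n n))

module _ {a d-1 : ℕ} .{cop : Coprime a (suc d-1)} where

  private
    μ = mkℚ (+ a) d-1 cop
    d = suc d-1

  toℚᵘ-μ*n : ∀ n → toℚᵘ (μ * ℕ→ℚ n) ℚᵘ.≃ + (a *ℕ n) ℚᵘ./ (d *ℕ 1)
  toℚᵘ-μ*n n = toℚᵘ-* a d n 1 ℚᵘ.≃-refl (toℚᵘ-/ n 1)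

  0≤μ*n : ∀ n → 0ℚ ≤ μ * ℕ→ℚ n
  0≤μ*n n = cross-≤⁺ 0 1 (a *ℕ n) (d *ℕ 1) ℚᵘ.≃-refl (toℚᵘ-μ*n n) z≤n

  a*n≤⌈μ*n⌉*d : ∀ n → a *ℕ n ℕ.≤ ceilμn μ n *ℕ d
  a*n≤⌈μ*n⌉*d n = subst₂ ℕ._≤_ (ℕ.*-identityʳ (a *ℕ n)) (cong (ceilμn μ n *ℕ_) (ℕ.*-identityʳ d))
    (cross-≤⁻ (a *ℕ n) (d *ℕ 1) (ceilμn μ n) 1 (toℚᵘ-μ*n n) (toℚᵘ-/ (ceilμn μ n) 1) (≤-⌈⌉ (0≤μ*n n)))

  μ≤½⇒2a≤d : μ ≤ ½ → 2 *ℕ a ℕ.≤ d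
  μ≤½⇒2a≤d μ≤½ = subst₂ ℕ._≤_ (ℕ.*-comm a 2) (ℕ.*-identityˡ d) (cross-≤⁻ a d 1 2 ℚᵘ.≃-refl ℚᵘ.≃-refl μ≤½)

  PrBig*μ^2k*n^k≤c^k : ∀ n (S : Fin n → Subset n) c k →
    #large n S μ *ℕ (a ℕ.^ (2 *ℕ k) *ℕ n ℕ.^ k) ℕ.≤ c ℕ.^ k *ℕ (n ℕ.^ n *ℕ d ℕ.^ (2 *ℕ k)) →
    PrBig n S μ * ((μ ^ℚ (2 *ℕ k)) * (ℕ→ℚ n ^ℚ k)) ≤ ℕ→ℚ c ^ℚ k
  PrBig*μ^2k*n^k≤c^k n S c k N*μ^2k*n^k≤c^k*nⁿ =
    cross-≤⁺ _ _ _ 1 {{ℕ.m*n≢0 (nⁿ n) (D *ℕ 1)}} Pr*μ^2k*n^k≃ (toℚᵘ-ℕ→ℚ-^ℚ c k)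
      (subst₂ ℕ._≤_ (sym (ℕ.*-identityʳ _)) (cong (λ x → c ℕ.^ k *ℕ (nⁿ n *ℕ x)) (sym (ℕ.*-identityʳ D)))
        N*μ^2k*n^k≤c^k*nⁿ)
    where
      D = d ℕ.^ (2 *ℕ k)
      instance
        nⁿ≢0 : NonZero (nⁿ n)
        nⁿ≢0 = nⁿ-nonZero n
        D≢0 : NonZero D
        D≢0 = ℕ.m^n≢0 d (2 *ℕ k)
        D*1≢0 : NonZero (D *ℕ 1)
        D*1≢0 = ℕ.m*n≢0 D 1
      Pr*μ^2k*n^k≃ = toℚᵘ-* (#large n S μ) (nⁿ n) _ (D *ℕ 1) (toℚᵘ-/ (#large n S μ) (nⁿ n))
        (toℚᵘ-* _ D _ 1 (toℚᵘ-^ℚ a d ℚᵘ.≃-refl (2 *ℕ k)) (toℚᵘ-ℕ→ℚ-^ℚ n k))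

claim3p5 : (n c : ℕ) (S : Fin n → Subset n) → (∀ y → ∣ S y ∣ ≡ c) →
    (μ : ℚ) → 0ℚ ≤ μ → μ ≤ ½ →
    PrBig n S μ * ((μ ^ℚ (2 *ℕ ceilμn μ n)) * (ℕ→ℚ n ^ℚ ceilμn μ n))
    ≤ ℕ→ℚ c ^ℚ ceilμn μ n
claim3p5 n c S ∣S∣≡c (mkℚ -[1+ _ ] _ _) (*≤* ()) _
claim3p5 n c S ∣S∣≡c μ@(mkℚ (+ a) d-1 _) _ μ≤½ =
  PrBig*μ^2k*n^k≤c^k n S c k (N*a^2k*n^k≤c^k*nⁿ*d^2k {#large n S μ} {n} {k} {c} {a} {suc d-1}
    (count-large-K n c S ∣S∣≡c k _ (⌈⌉-≤ _ (0≤μ*n n)))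
    (nCk*a^2k≤d^2k {n} {k} (μ≤½⇒2a≤d μ≤½) (a*n≤⌈μ*n⌉*d n)))
  where k = ceilμn μ n
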